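{- Let $R$ be a unique factorization domain and let $f(s)=\sum_{i=1}^{n}\frac{a_i}{i^s}$ be a Dirichlet polynomial with coefficients $a_i\in R$, $a_n\neq 0$, whose degree $n$ is a composite number, and let $p_n$ be the smallest prime divisor of $n$. If $f$ has a nonzero coefficient $a_i$ with $n-p_n<i<n$, then $f$ is irreducible, i.e. $f$ cannot be written as a product of two nonconstant Dirichlet polynomials with coefficients in $R$.
   Context: A Dirichlet polynomial with coefficients in $R$ is a finite sum $\sum_{i}\frac{a_i}{i^s}$ ($i$ positive integers, $a_i\in R$, $s$ an indeterminate). Sums are added termwise and multiplied by the Dirichlet product: $\left(\sum_j\frac{b_j}{j^s}\right)\left(\sum_k\frac{c_k}{k^s}\right)=\sum_i\frac{\sum_{jk=i}b_jc_k}{i^s}$. The degree of a nonzero $f$ is the largest $i$ with $a_i\neq0$. A Dirichlet polynomial is constant if its only possibly nonzero term is $\frac{a_1}{1^s}$. -}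

module Defs where

open import Level using (Level; _⊔_)
open import Algebra.Bundles using (CommutativeRing)
open import Data.Nat using (ℕ; zero; suc; _<_; _≤_; _≟_)
open import Data.Nat.Divisibility using (_∣_)
open import Data.Nat.Primality using (Prime)
open import Data.List using (List; foldr)
open import Data.List.Relation.Unary.All using (All)
open import Data.List.Relation.Binary.Pointwise using (Pointwise)
open import Data.List.Relation.Binary.Permutation.Propositional using (_↭_)
open import Data.Product using (Σ; ∃; _×_)
open import Data.Sum using (_⊎_)
open import Relation.Nullary using (¬_; yes; no)

IsSmallestPrimeDivisor : ℕ → ℕ → Set
IsSmallestPrimeDivisor p n = Prime p × p ∣ n × (∀ q → Prime q → q ∣ n → p ≤ q)

module _ {c ℓ : Level} (R : CommutativeRing c ℓ) where
  open CommutativeRing R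

  IsUnit : Carrier → Set (c ⊔ ℓ)
  IsUnit u = ∃ λ v → u * v ≈ 1#

  IsIrreducibleElt : Carrier → Set (c ⊔ ℓ)
  IsIrreducibleElt p = (¬ p ≈ 0#) × (¬ IsUnit p)
                       × (∀ a b → p ≈ a * b → IsUnit a ⊎ IsUnit b)

  Associated : Carrier → Carrier → Set (c ⊔ ℓ)
  Associated a b = ∃ λ u → IsUnit u × b ≈ u * a

  listProd : List Carrier → Carrier
  listProd = foldr _*_ 1#

  record IsUFD : Set (c ⊔ ℓ) where
    field
      nontrivial     : ¬ 1# ≈ 0#
      noZeroDivisors : ∀ a b → a * b ≈ 0# → a ≈ 0# ⊎ b ≈ 0#
      factorization  : ∀ a → ¬ a ≈ 0# → ¬ IsUnit a →
                       ∃ λ ps → All IsIrreducibleElt ps × a ≈ listProd ps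
      uniqueness     : ∀ ps qs → All IsIrreducibleElt ps → All IsIrreducibleElt qs →
                       listProd ps ≈ listProd qs →
                       ∃ λ qs' → (qs' ↭ qs) × Pointwise Associated ps qs'

  -- Dirichlet polynomials: coefficient functions a : ℕ → R, where a i is the
  -- coefficient of 1/i^s; index 0 is unused (forced to be 0), and only
  -- finitely many coefficients are nonzero.
  record DirPoly : Set (c ⊔ ℓ) where
    field
      coeff   : ℕ → Carrier
      coeff0  : coeff 0 ≈ 0#
      bound   : ℕ
      vanish  : ∀ i → bound < i → coeff i ≈ 0#
  open DirPoly public

  sumTo : (ℕ → Carrier) → ℕ → Carrier
  sumTo f zero    = 0#
  sumTo f (suc m) = sumTo f m + f (suc m)

  dirMulCoeff : (ℕ → Carrier) → (ℕ → Carrier) → ℕ → Carrier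
  dirMulCoeff g h i =
    sumTo (λ j → sumTo (λ k → term j k) i) i
    where
      term : ℕ → ℕ → Carrier
      term j k with j Data.Nat.* k ≟ i
      ... | yes _ = g j * h k
      ... | no  _ = 0#

  NonConstant : DirPoly → Set ℓ
  NonConstant g = ∃ λ i → 1 < i × ¬ coeff g i ≈ 0#

{-# OPTIONS --safe #-}
-- If f = g h with g, h nonconstant of degrees d, e, then the coefficient of f at d e is g_d h_e,
-- which is nonzero as R has no zero divisors; hence n = d e, and d, e ≥ p since both are
-- nontrivial divisors of n. Every other product j k with j ≤ d, k ≤ e satisfies
-- j k ≤ d e − min(d, e) ≤ n − p, so no coefficient of f strictly between n − p and n survives.
module Submission where

open import Defs
open import Algebra.Bundles using (CommutativeRing)
open import Data.Nat
  using (ℕ; zero; suc; z<s; s≤s; >-nonZero; _<_; _≤_; _+_; _*_; _∸_; _≟_; _≤?_)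
open import Data.Nat.Properties
  using (≤-refl; ≤-trans; ≤-pred; <-irrefl; <⇒≢; >⇒≢; <-≤-trans; ≤-<-trans; ≤∧≢⇒<; ≰⇒>;
         ≮⇒≥; <⇒≤; <⇒≱; ≤-antisym; n<1+n; m≤n⇒m≤1+n; m<n⇒m<1+n; +-mono-≤; +-monoˡ-≤;
         +-monoʳ-<; *-suc; *-comm; *-monoʳ-≤; *-monoˡ-≤; m≤n+m∸n; m≤m*n; m≤n*m;
         module ≤-Reasoning)
open import Data.Nat.Divisibility using (_∣_; divides; ∣-trans; ∣⇒≤)
open import Data.Nat.Primality using (Prime; Composite)
open import Data.Nat.Primality.Factorisation using (factorise)
open import Data.Nat.ListAction using (product)
open import Data.List using ([]; _∷_)
open import Data.List.Relation.Unary.All using (_∷_)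
open import Data.Product using (Σ; ∃; _×_; _,_)
open import Data.Sum using (_⊎_; [_,_])
open import Relation.Nullary using (¬_; yes; no)
open import Relation.Nullary.Negation using (contradiction; ¬¬-map)
open import Relation.Binary.PropositionalEquality as ≡ using (_≡_; _≢_; refl; ≢-sym)

m∸n<o⇒m<n+o : ∀ m n {o} → m ∸ n < o → m < n + o
m∸n<o⇒m<n+o m n m∸n<o = ≤-<-trans (m≤n+m∸n m n) (+-monoʳ-< n m∸n<o)

m+j*k≤d*e : ∀ {m j k d e} → j ≤ d → k ≤ e → ¬ (j ≡ d × k ≡ e) → m ≤ d → m ≤ e →
            m + j * k ≤ d * e
m+j*k≤d*e {m} {j} {k} {d} {e} j≤d k≤e off-corner m≤d m≤e with j ≟ d
... | yes refl = begin
  m + j * k  ≤⟨ +-monoˡ-≤ (j * k) m≤d ⟩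
  j + j * k  ≡⟨ *-suc j k ⟨
  j * suc k  ≤⟨ *-monoʳ-≤ j (≤∧≢⇒< k≤e (λ k≡e → off-corner (refl , k≡e))) ⟩
  j * e      ∎
  where open ≤-Reasoning
... | no j≢d = begin
  m + j * k  ≤⟨ +-mono-≤ m≤e (*-monoʳ-≤ j k≤e) ⟩
  suc j * e  ≤⟨ *-monoˡ-≤ e (≤∧≢⇒< j≤d j≢d) ⟩
  d * e      ∎
  where open ≤-Reasoning

primeDivisor : ∀ {n} → 1 < n → ∃ λ q → Prime q × q ∣ n
primeDivisor {suc n} 1<n with factorise (suc n)
... | record { factors = [] ; isFactorisation = refl } = contradiction 1<n (<-irrefl refl)
... | record { factors = q ∷ qs ; isFactorisation = eq ; factorsPrime = q-prime ∷ _ } =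
  q , q-prime , divides (product qs) (≡.trans eq (*-comm q (product qs)))

smallestPrimeDivisor-≤ : ∀ {p n d} → IsSmallestPrimeDivisor p n → 1 < d → d ∣ n → p ≤ d
smallestPrimeDivisor-≤ {d = suc d} (_ , _ , p-min) 1<d d∣n with primeDivisor 1<d
... | q , q-prime , q∣d = ≤-trans (p-min q q-prime (∣-trans q∣d d∣n)) (∣⇒≤ q∣d)

module DirichletProduct {c ℓ} (R : CommutativeRing c ℓ) where
  open CommutativeRing R
    using (Carrier; _≈_; 0#; +-cong; *-cong; +-identityˡ; +-identityʳ; zeroˡ; zeroʳ)
    renaming (_*_ to _·_; refl to ≈-refl; sym to ≈-sym; trans to ≈-trans)

  Degree : (ℕ → Carrier) → ℕ → Set ℓ
  Degree g d = ¬ g d ≈ 0# × (∀ i → d < i → g i ≈ 0#)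

  -- Equality of coefficients is not decidable, so a degree exists only up to double negation.
  ¬¬degree-≥ : ∀ {g : ℕ → Carrier} {w} m → 0 < w → ¬ g w ≈ 0# → (∀ i → m < i → g i ≈ 0#) →
               ¬ ¬ (∃ λ d → w ≤ d × Degree g d)
  ¬¬degree-≥ zero 0<w gw≉0 vanish _ = gw≉0 (vanish _ 0<w)
  ¬¬degree-≥ {g} {w} (suc m) 0<w gw≉0 vanish no-degree with w ≤? suc m
  ... | no w≰1+m = gw≉0 (vanish w (≰⇒> w≰1+m))
  ... | yes w≤1+m = no-degree (suc m , w≤1+m , g[1+m]≉0 , vanish)
    where
    g[1+m]≉0 : ¬ g (suc m) ≈ 0#
    g[1+m]≉0 g[1+m]≈0 = ¬¬degree-≥ m 0<w gw≉0 vanish-above-m no-degree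
      where
      vanish-above-m : ∀ i → m < i → g i ≈ 0#
      vanish-above-m i m<i with i ≟ suc m
      ... | yes refl = g[1+m]≈0
      ... | no i≢1+m = vanish i (≤∧≢⇒< m<i (≢-sym i≢1+m))

  nonConstant⇒¬¬degree : (g : DirPoly R) → NonConstant R g →
                         ¬ ¬ (∃ λ d → 1 < d × Degree (coeff g) d)
  nonConstant⇒¬¬degree g (w , 1<w , gw≉0) =
    ¬¬-map (λ (d , w≤d , degree) → d , <-≤-trans 1<w w≤d , degree)
           (¬¬degree-≥ (bound g) (<⇒≤ 1<w) gw≉0 (vanish g))

  sumTo-≈0 : ∀ f m → (∀ j → 0 < j → j ≤ m → f j ≈ 0#) → sumTo R f m ≈ 0#
  sumTo-≈0 f zero    _      = ≈-refl
  sumTo-≈0 f (suc m) f≈0 =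
    ≈-trans (+-cong (sumTo-≈0 f m (λ j 0<j j≤m → f≈0 j 0<j (m≤n⇒m≤1+n j≤m)))
                    (f≈0 (suc m) z<s ≤-refl))
            (+-identityˡ 0#)

  sumTo-single : ∀ f m {t} → 0 < t → t ≤ m → (∀ j → 0 < j → j ≤ m → j ≢ t → f j ≈ 0#) →
                 sumTo R f m ≈ f t
  sumTo-single f zero    z<s ()
  sumTo-single f (suc m) {t} 0<t t≤1+m f≈0 with t ≟ suc m
  ... | yes refl =
    ≈-trans (+-cong (sumTo-≈0 f m (λ j 0<j j≤m → f≈0 j 0<j (m≤n⇒m≤1+n j≤m) (<⇒≢ (s≤s j≤m))))
                    ≈-refl)
            (+-identityˡ _)
  ... | no t≢1+m =
    ≈-trans (+-cong (sumTo-single f m 0<t (≤-pred (≤∧≢⇒< t≤1+m t≢1+m))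
                                  (λ j 0<j j≤m → f≈0 j 0<j (m≤n⇒m≤1+n j≤m)))
                    (f≈0 (suc m) z<s ≤-refl (≢-sym t≢1+m)))
            (+-identityʳ _)

  -- The summand of dirMulCoeff is local to its where-block; unification names it here.
  mutual
    dirichletTerm : (g h : ℕ → Carrier) (i j k : ℕ) → Carrier
    dirichletTerm = _

    dirMulCoeff-unfold : ∀ g h i →
      dirMulCoeff R g h i ≡ sumTo R (λ j → sumTo R (dirichletTerm g h i j) i) i
    dirMulCoeff-unfold g h i = refl

  dirichletTerm-≡ : ∀ {g h i j k} → j * k ≡ i → dirichletTerm g h i j k ≈ g j · h k
  dirichletTerm-≡ {i = i} {j} {k} jk≡i with j * k ≟ i
  ... | yes _    = ≈-refl
  ... | no jk≢i = contradiction jk≡i jk≢i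

  dirichletTerm-≈0 : ∀ {g h i j k} → (j * k ≡ i → g j · h k ≈ 0#) → dirichletTerm g h i j k ≈ 0#
  dirichletTerm-≈0 {i = i} {j} {k} gh≈0 with j * k ≟ i
  ... | yes jk≡i = gh≈0 jk≡i
  ... | no _     = ≈-refl

  dirMulCoeff-≈0 : ∀ g h i → (∀ j k → 0 < j → 0 < k → j * k ≡ i → g j · h k ≈ 0#) →
                   dirMulCoeff R g h i ≈ 0#
  dirMulCoeff-≈0 g h i gh≈0 = ≡.subst (_≈ 0#) (≡.sym (dirMulCoeff-unfold g h i))
    (sumTo-≈0 _ i λ j 0<j _ → sumTo-≈0 _ i λ k 0<k _ →
      dirichletTerm-≈0 {g} {h} (gh≈0 j k 0<j 0<k))

  dirMulCoeff-single : ∀ g h {i d e} → 0 < d → 0 < e → d * e ≡ i →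
    (∀ j k → 0 < j → 0 < k → j * k ≡ i → ¬ (j ≡ d × k ≡ e) → g j · h k ≈ 0#) →
    dirMulCoeff R g h i ≈ g d · h e
  dirMulCoeff-single g h {i} {d} {e} 0<d 0<e refl gh≈0 =
    ≡.subst (_≈ g d · h e) (≡.sym (dirMulCoeff-unfold g h i)) (≈-trans
      (sumTo-single _ i 0<d d≤i λ j 0<j _ j≢d →
        sumTo-≈0 _ i λ k 0<k _ → dirichletTerm-≈0 {g} {h} λ jk≡i →
          gh≈0 j k 0<j 0<k jk≡i λ (j≡d , _) → j≢d j≡d)
      (≈-trans
        (sumTo-single _ i 0<e e≤i λ k 0<k _ k≢e →
          dirichletTerm-≈0 {g} {h} λ dk≡i → gh≈0 d k 0<d 0<k dk≡i λ (_ , k≡e) → k≢e k≡e)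
        (dirichletTerm-≡ {g} {h} refl)))
    where
    d≤i : d ≤ d * e
    d≤i = m≤m*n d e {{>-nonZero 0<e}}
    e≤i : e ≤ d * e
    e≤i = m≤n*m e d {{>-nonZero 0<d}}

  module _ {g h : ℕ → Carrier} {d e : ℕ}
           (g-vanish : ∀ j → d < j → g j ≈ 0#) (h-vanish : ∀ k → e < k → h k ≈ 0#) where

    product-≈0-off-corner : ∀ {m j k} → m ≤ d → m ≤ e → d * e < m + j * k →
                            ¬ (j ≡ d × k ≡ e) → g j · h k ≈ 0#
    product-≈0-off-corner {j = j} {k} m≤d m≤e de<m+jk off-corner with j ≤? d | k ≤? e
    ... | no j≰d | _       = ≈-trans (*-cong (g-vanish j (≰⇒> j≰d)) ≈-refl) (zeroˡ _)
    ... | yes _  | no k≰e  = ≈-trans (*-cong ≈-refl (h-vanish k (≰⇒> k≰e))) (zeroʳ _)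
    ... | yes j≤d | yes k≤e = contradiction (m+j*k≤d*e j≤d k≤e off-corner m≤d m≤e) (<⇒≱ de<m+jk)

    dirMulCoeff-gap : ∀ {m i} → m ≤ d → m ≤ e → d * e < m + i → i ≢ d * e →
                      dirMulCoeff R g h i ≈ 0#
    dirMulCoeff-gap {i = i} m≤d m≤e de<m+i i≢de = dirMulCoeff-≈0 g h i λ where
      j k _ _ refl → product-≈0-off-corner m≤d m≤e de<m+i λ where
        (refl , refl) → i≢de refl

    dirMulCoeff-leading : 0 < d → 0 < e → dirMulCoeff R g h (d * e) ≈ g d · h e
    dirMulCoeff-leading 0<d 0<e = dirMulCoeff-single g h 0<d 0<e refl λ where
      j k _ _ jk≡de → product-≈0-off-corner 0<d 0<e
                        (≡.subst (d * e <_) (≡.cong suc (≡.sym jk≡de)) (n<1+n (d * e)))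

  module _ (noZeroDivisors : ∀ a b → a · b ≈ 0# → a ≈ 0# ⊎ b ≈ 0#) where

    degree-dirMul : ∀ {f g h n d e} → Degree f n → Degree g d → Degree h e → 0 < d → 0 < e →
                    (∀ i → f i ≈ dirMulCoeff R g h i) → n ≡ d * e
    degree-dirMul {g = g} {h} {n} {d} {e} (fn≉0 , f-vanish) (gd≉0 , g-vanish) (he≉0 , h-vanish)
                  0<d 0<e f≈gh = ≤-antisym n≤de de≤n
      where
      n≤de : n ≤ d * e
      n≤de = ≮⇒≥ λ de<n → fn≉0 (≈-trans (f≈gh n)
        (dirMulCoeff-gap g-vanish h-vanish 0<d 0<e (m<n⇒m<1+n de<n) (>⇒≢ de<n)))

      de≤n : d * e ≤ n
      de≤n = ≮⇒≥ λ n<de → [ gd≉0 , he≉0 ] (noZeroDivisors (g d) (h e)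
        (≈-trans (≈-sym (dirMulCoeff-leading g-vanish h-vanish 0<d 0<e))
                 (≈-trans (≈-sym (f≈gh (d * e))) (f-vanish (d * e) n<de))))

proposition2p3 : ∀ {c ℓ} (R : CommutativeRing c ℓ) → IsUFD R →
    let open CommutativeRing R in
    (n : ℕ) (a : ℕ → Carrier) →
    a 0 ≈ 0# → (∀ i → n < i → a i ≈ 0#) → ¬ a n ≈ 0# →
    Composite n →
    (p : ℕ) → IsSmallestPrimeDivisor p n →
    (∃ λ i → (n ∸ p < i) × (i < n) × ¬ a i ≈ 0#) →
    ¬ (Σ (DirPoly R) λ g → Σ (DirPoly R) λ h →
         NonConstant R g × NonConstant R h ×
         (∀ i → a i ≈ dirMulCoeff R (coeff g) (coeff h) i))
proposition2p3 R ufd n a _ a-vanish an≉0 _ p p-smallest (i , n∸p<i , i<n , ai≉0)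
               (g , h , g-nonConstant , h-nonConstant , a≈gh) =
  nonConstant⇒¬¬degree g g-nonConstant λ (d , 1<d , g-degree@(_ , g-vanish)) →
  nonConstant⇒¬¬degree h h-nonConstant λ (e , 1<e , h-degree@(_ , h-vanish)) →
  let n≡de = degree-dirMul noZeroDivisors (an≉0 , a-vanish) g-degree h-degree
                           (<⇒≤ 1<d) (<⇒≤ 1<e) a≈gh
      p≤d  = smallestPrimeDivisor-≤ p-smallest 1<d (divides e (≡.trans n≡de (*-comm d e)))
      p≤e  = smallestPrimeDivisor-≤ p-smallest 1<e (divides d n≡de)
      de<p+i = ≡.subst (_< p + i) n≡de (m∸n<o⇒m<n+o n p n∸p<i)
      i≢de = λ i≡de → <-irrefl (≡.trans i≡de (≡.sym n≡de)) i<n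
  in ai≉0 (trans (a≈gh i)
                 (dirMulCoeff-gap g-vanish h-vanish p≤d p≤e de<p+i i≢de))
  where
  open CommutativeRing R using (trans)
  open IsUFD ufd using (noZeroDivisors)
  open DirichletProduct R
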